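{- Let $\Sigma$ be a context, $a,b$ terms of the same name type well-typed in $\Sigma$, and $\phi$ a formula well-formed in $\Sigma$. In $NL^{\Rightarrow}$: if $\Sigma;\Gamma,(a\ b)\cdot\phi\Rightarrow\Delta$ is derivable then $\Sigma;\Gamma,\phi\Rightarrow\Delta$ is derivable with a derivation of the same logical height; and if $\Sigma;\Gamma\Rightarrow(a\ b)\cdot\phi,\Delta$ is derivable then $\Sigma;\Gamma\Rightarrow\phi,\Delta$ is derivable with a derivation of the same logical height.
   Context: Syntax. Types $\tau ::= \delta \mid \nu \mid \langle\nu\rangle\tau$ ($\delta$ data types, $\nu$ name types). Disjoint countably infinite sets of variables and name-symbols $\mathsf a,\mathsf b,\dots$. Signature with constants, function and relation symbols always including swapping $(a\ b)\cdot t$, abstraction $\langle a\rangle t$, equality $t\approx u$, freshness $a\mathrel{\#}t$. Formulas: $\top,\bot$, atoms, $\wedge,\vee,\supset,\forall,\exists$, and the fresh-name quantifier $\mathsf N\mathsf a{:}\nu.\phi$. Swapping on formulas: $(a\ b)\cdot\top=\top$, $(a\ b)\cdot\bot=\bot$, $(a\ b)\cdot p(\vec t)=p((a\ b)\cdot\vec t)$, $(a\ b)\cdot(\phi\circ\psi)=(a\ b)\cdot\phi\circ(a\ b)\cdot\psi$ for $\circ\in\{\wedge,\vee,\supset\}$, $(a\ b)\cdot Qx.\phi=Qx.(a\ b)\cdot\phi$ for $Q\in\{\forall,\exists\}$ with $x$ not free in $a,b$, and $(a\ b)\cdot\mathsf N\mathsf a.\phi=\mathsf N\mathsf a.(a\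 b)\cdot\phi$ with $\mathsf a$ not occurring in $a,b$. Contexts $\Sigma ::= \cdot \mid \Sigma,x{:}\tau \mid \Sigma\#\mathsf a{:}\nu$; $|\cdot|=\emptyset$, $|\Sigma,x{:}\tau|=|\Sigma|$, $|\Sigma\#\mathsf a{:}\nu|=|\Sigma|\cup\{\mathsf a\mathrel{\#}t\mid t\text{ well-typed in }\Sigma\}$. Rules of $NL^{\Rightarrow}$. Logical rules: hyp ($\Sigma;\Gamma,P\Rightarrow P,\Delta$, $P$ atomic), $\top R$, $\bot L$, classical G3c rules for $\wedge,\vee,\supset,\forall,\exists$, $\mathsf N R$ (from $\Sigma\#\mathsf a{:}\nu;\Gamma\Rightarrow\phi,\Delta$, $\mathsf a\notin\Sigma$, infer $\Sigma;\Gamma\Rightarrow\mathsf N\mathsf a{:}\nu.\phi,\Delta$), $\mathsf N L$ (symmetric on the left). Nonlogical rules: $\approx R$ (from $\Gamma,t\approx t\Rightarrow\Delta$ infer $\Gamma\Rightarrow\Delta$), $\approx S$ (from $\Gamma,t\approx u,P(t),P(u)\Rightarrow\Delta$ infer $\Gamma,t\approx u,P(t)\Rightarrow\Delta$), Ax (for each instance $\bigwedge\vec P\supset Q_1\vee\dots\vee Q_m$ of (S1) $(a\ a)\cdot x\approx x$, (S2) $(a\ b)\cdot(a\ b)\cdot x\approx x$, (S3) $(a\ b)\cdot a\approx b$, (E1) $(a\ b)\cdot c\approx c$, (E2) $(a\ b)\cdot f(\vec t)\approx f((a\ b)\cdot\vec t)$, (E3) $p(\vec t)\supset p((a\ b)\cdot\vec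 t)$, (F1) $a\mathrel{\#}x\wedge b\mathrel{\#}x\supset(a\ b)\cdot x\approx x$, (F2) $a\mathrel{\#}b$ for distinct name types, (F3) $a\mathrel{\#}a\supset\bot$, (F4) $a\mathrel{\#}b\vee a\approx b$, (A1) $a\mathrel{\#}y\wedge x\approx(a\ b)\cdot y\supset\langle a\rangle x\approx\langle b\rangle y$: from $\Gamma,\vec P,Q_i\Rightarrow\Delta$ for all $i$ infer $\Gamma,\vec P\Rightarrow\Delta$), $A_2$ (from $\Gamma,\langle a\rangle t\approx\langle b\rangle u,a\approx b,t\approx u\Rightarrow\Delta$ and $\Gamma,\langle a\rangle t\approx\langle b\rangle u,a\mathrel{\#}u,t\approx(a\ b)\cdot u\Rightarrow\Delta$ infer $\Gamma,\langle a\rangle t\approx\langle b\rangle u\Rightarrow\Delta$), $A_3$ (from $\Sigma\vdash t:\langle\nu\rangle\sigma$ and $\Sigma,a{:}\nu,x{:}\sigma;\Gamma,t\approx\langle a\rangle x\Rightarrow\Delta$ infer $\Sigma;\Gamma\Rightarrow\Delta$), $F$ (from $\Sigma\#\mathsf a{:}\nu;\Gamma\Rightarrow\Delta$, $\mathsf a\notin\Sigma$, infer $\Sigma;\Gamma\Rightarrow\Delta$), $\Sigma\#$ (from $\Sigma;\Gamma,\mathsf a\mathrel{\#}t\Rightarrow\Delta$, $\mathsf a\mathrel{\#}t\in|\Sigma|$, infer $\Sigma;\Gamma\Rightarrow\Delta$). The logical height of a derivation is the maximum number of logical-rule applications along any branch. -}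

module Defs where

open import Data.Nat using (ℕ; zero; suc; _⊔_)
open import Data.List using (List; []; _∷_; _++_; map)
open import Data.List.Relation.Unary.All using (All; []; _∷_)
open import Data.List.Relation.Binary.Permutation.Propositional using (_↭_)
open import Relation.Binary.PropositionalEquality using (_≡_; _≢_)

data Ty (D N : Set) : Set where
  dat : D → Ty D N
  nam : N → Ty D N
  abs : N → Ty D N → Ty D N

-- Swapping, abstraction, equality and freshness are built in below.

record Sig : Set₁ where
  field
    DTy NTy Con Fun Rel : Set
    conTy   : Con → Ty DTy NTy
    funArgs : Fun → List (Ty DTy NTy)
    funRes  : Fun → Ty DTy NTy
    relArgs : Rel → List (Ty DTy NTy)

module NL (𝕊 : Sig) where
  open Sig 𝕊

  Type : Set
  Type = Ty DTy NTy

  data FSym : Set where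
    swp ab : FSym
    usr    : Fun → FSym

  data PSym : Set where
    eqP frP : PSym
    usr     : Rel → PSym

  -- Terms. Variables and name-symbols are two disjoint de Bruijn index
  -- spaces (var i / nm i), bound by the context or by ∀,∃ resp. И.

  data Tm : Set where
    var : ℕ → Tm
    nm  : ℕ → Tm
    con : Con → Tm
    fn  : FSym → List Tm → Tm

  sw : Tm → Tm → Tm → Tm
  sw a b t = fn swp (a ∷ b ∷ t ∷ [])

  abst : Tm → Tm → Tm
  abst a t = fn ab (a ∷ t ∷ [])

  infixr 8 _∧f_
  infixr 7 _∨f_
  infixr 6 _⊃f_

  data Fm : Set where
    ⊤f ⊥f : Fm
    atom  : PSym → List Tm → Fm
    _∧f_ _∨f_ _⊃f_ : Fm → Fm → Fm
    ∀f ∃f : Type → Fm → Fm      -- binds var 0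
    Иf    : NTy → Fm → Fm       -- fresh-name quantifier, binds nm 0

  infix 9 _≈_ _#_
  _≈_ : Tm → Tm → Fm
  t ≈ u = atom eqP (t ∷ u ∷ [])

  _#_ : Tm → Tm → Fm
  a # t = atom frP (a ∷ t ∷ [])

  data Atomic : Fm → Set where
    atom : ∀ p ts → Atomic (atom p ts)

  mutual
    sub : (ℕ → Tm) → (ℕ → ℕ) → Tm → Tm
    sub σ ρ (var i)   = σ i
    sub σ ρ (nm i)    = nm (ρ i)
    sub σ ρ (con c)   = con c
    sub σ ρ (fn f ts) = fn f (subs σ ρ ts)

    subs : (ℕ → Tm) → (ℕ → ℕ) → List Tm → List Tm
    subs σ ρ []       = []
    subs σ ρ (t ∷ ts) = sub σ ρ t ∷ subs σ ρ ts

  wkV : Tm → Tm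
  wkV = sub (λ i → var (suc i)) (λ i → i)

  wkN : Tm → Tm
  wkN = sub var suc

  liftV : (ℕ → Tm) → ℕ → Tm
  liftV σ zero    = var zero
  liftV σ (suc i) = wkV (σ i)

  liftN : (ℕ → ℕ) → ℕ → ℕ
  liftN ρ zero    = zero
  liftN ρ (suc i) = suc (ρ i)

  subF : (ℕ → Tm) → (ℕ → ℕ) → Fm → Fm
  subF σ ρ ⊤f          = ⊤f
  subF σ ρ ⊥f          = ⊥f
  subF σ ρ (atom p ts) = atom p (subs σ ρ ts)
  subF σ ρ (φ ∧f ψ)    = subF σ ρ φ ∧f subF σ ρ ψ
  subF σ ρ (φ ∨f ψ)    = subF σ ρ φ ∨f subF σ ρ ψ
  subF σ ρ (φ ⊃f ψ)    = subF σ ρ φ ⊃f subF σ ρ ψ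
  subF σ ρ (∀f τ φ)    = ∀f τ (subF (liftV σ) ρ φ)
  subF σ ρ (∃f τ φ)    = ∃f τ (subF (liftV σ) ρ φ)
  subF σ ρ (Иf ν φ)    = Иf ν (subF (λ i → wkN (σ i)) (liftN ρ) φ)

  wkVF : Fm → Fm
  wkVF = subF (λ i → var (suc i)) (λ i → i)

  wkNF : Fm → Fm
  wkNF = subF var suc

  -- φ[t/x] where x is the variable var 0 bound by the enclosing binder
  single : Tm → ℕ → Tm
  single t zero    = t
  single t (suc i) = var i

  inst : Fm → Tm → Fm
  inst φ t = subF (single t) (λ i → i) φ

  swapF : Tm → Tm → Fm → Fm
  swapF a b ⊤f          = ⊤f
  swapF a b ⊥f          = ⊥f
  swapF a b (atom p ts) = atom p (map (sw a b) ts)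
  swapF a b (φ ∧f ψ)    = swapF a b φ ∧f swapF a b ψ
  swapF a b (φ ∨f ψ)    = swapF a b φ ∨f swapF a b ψ
  swapF a b (φ ⊃f ψ)    = swapF a b φ ⊃f swapF a b ψ
  swapF a b (∀f τ φ)    = ∀f τ (swapF (wkV a) (wkV b) φ)
  swapF a b (∃f τ φ)    = ∃f τ (swapF (wkV a) (wkV b) φ)
  swapF a b (Иf ν φ)    = Иf ν (swapF (wkN a) (wkN b) φ)

  infixl 5 _,v_ _#n_
  data Ctx : Set where
    ε    : Ctx
    _,v_ : Ctx → Type → Ctx
    _#n_ : Ctx → NTy → Ctx

  data _∋v_∶_ : Ctx → ℕ → Type → Set where
    here  : ∀ {C τ} → (C ,v τ) ∋v zero ∶ τ
    there : ∀ {C i τ σ} → C ∋v i ∶ τ → (C ,v σ) ∋v suc i ∶ τ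
    skip  : ∀ {C i τ ν} → C ∋v i ∶ τ → (C #n ν) ∋v i ∶ τ

  data _∋n_∶_ : Ctx → ℕ → NTy → Set where
    here  : ∀ {C ν} → (C #n ν) ∋n zero ∶ ν
    there : ∀ {C i ν μ} → C ∋n i ∶ ν → (C #n μ) ∋n suc i ∶ ν
    skip  : ∀ {C i ν τ} → C ∋n i ∶ ν → (C ,v τ) ∋n i ∶ ν

  infix 4 _⊢_∶_ _⊢*_∶_ _⊢_wf
  mutual
    data _⊢_∶_ (C : Ctx) : Tm → Type → Set where
      var : ∀ {i τ} → C ∋v i ∶ τ → C ⊢ var i ∶ τ
      nm  : ∀ {i ν} → C ∋n i ∶ ν → C ⊢ nm i ∶ nam ν
      con : ∀ c → C ⊢ con c ∶ conTy c
      swp : ∀ {a b t ν τ} → C ⊢ a ∶ nam ν → C ⊢ b ∶ nam ν → C ⊢ t ∶ τ →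
            C ⊢ sw a b t ∶ τ
      ab  : ∀ {a t ν τ} → C ⊢ a ∶ nam ν → C ⊢ t ∶ τ → C ⊢ abst a t ∶ abs ν τ
      usr : ∀ {f ts} → C ⊢* ts ∶ funArgs f → C ⊢ fn (usr f) ts ∶ funRes f

    data _⊢*_∶_ (C : Ctx) : List Tm → List Type → Set where
      []  : C ⊢* [] ∶ []
      _∷_ : ∀ {t ts τ τs} → C ⊢ t ∶ τ → C ⊢* ts ∶ τs → C ⊢* t ∷ ts ∶ τ ∷ τs

  data _⊢_wf (C : Ctx) : Fm → Set where
    ⊤f  : C ⊢ ⊤f wf
    ⊥f  : C ⊢ ⊥f wf
    eq  : ∀ {t u τ} → C ⊢ t ∶ τ → C ⊢ u ∶ τ → C ⊢ t ≈ u wf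
    fr  : ∀ {a t ν τ} → C ⊢ a ∶ nam ν → C ⊢ t ∶ τ → C ⊢ a # t wf
    rel : ∀ {r ts} → C ⊢* ts ∶ relArgs r → C ⊢ atom (usr r) ts wf
    and : ∀ {φ ψ} → C ⊢ φ wf → C ⊢ ψ wf → C ⊢ φ ∧f ψ wf
    or  : ∀ {φ ψ} → C ⊢ φ wf → C ⊢ ψ wf → C ⊢ φ ∨f ψ wf
    imp : ∀ {φ ψ} → C ⊢ φ wf → C ⊢ ψ wf → C ⊢ φ ⊃f ψ wf
    all : ∀ {τ φ} → C ,v τ ⊢ φ wf → C ⊢ ∀f τ φ wf
    ex  : ∀ {τ φ} → C ,v τ ⊢ φ wf → C ⊢ ∃f τ φ wf
    new : ∀ {ν φ} → C #n ν ⊢ φ wf → C ⊢ Иf ν φ wf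

  -- |Σ| : the freshness facts recorded by a context.
  -- |Σ#a:ν| = |Σ| ∪ { a # t | t well-typed in Σ }  (indices shifted)

  data _∋#_ : Ctx → Fm → Set where
    new : ∀ {C t τ ν} → C ⊢ t ∶ τ → (C #n ν) ∋# (nm zero # wkN t)
    wv  : ∀ {C φ τ} → C ∋# φ → (C ,v τ) ∋# wkVF φ
    wn  : ∀ {C φ ν} → C ∋# φ → (C #n ν) ∋# wkNF φ

  -- Instances  ⋀P⃗ ⊃ Q₁ ∨ … ∨ Qₘ  of the nonlogical axioms, as the pair
  -- (P⃗ , [Q₁,…,Qₘ]) of lists of atoms (m = 0 means ⊥).

  data Ax (C : Ctx) : List Fm → List Fm → Set where
    S1 : ∀ {a x ν τ} → C ⊢ a ∶ nam ν → C ⊢ x ∶ τ →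
         Ax C [] (sw a a x ≈ x ∷ [])
    S2 : ∀ {a b x ν τ} → C ⊢ a ∶ nam ν → C ⊢ b ∶ nam ν → C ⊢ x ∶ τ →
         Ax C [] (sw a b (sw a b x) ≈ x ∷ [])
    S3 : ∀ {a b ν} → C ⊢ a ∶ nam ν → C ⊢ b ∶ nam ν →
         Ax C [] (sw a b a ≈ b ∷ [])
    E1 : ∀ {a b ν} c → C ⊢ a ∶ nam ν → C ⊢ b ∶ nam ν →
         Ax C [] (sw a b (con c) ≈ con c ∷ [])
    E2 : ∀ {a b ν f ts τ} → C ⊢ a ∶ nam ν → C ⊢ b ∶ nam ν → C ⊢ fn f ts ∶ τ →
         Ax C [] (sw a b (fn f ts) ≈ fn f (map (sw a b) ts) ∷ [])
    E3 : ∀ {a b ν p ts} → C ⊢ a ∶ nam ν → C ⊢ b ∶ nam ν → C ⊢ atom p ts wf →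
         Ax C (atom p ts ∷ []) (atom p (map (sw a b) ts) ∷ [])
    F1 : ∀ {a b x ν τ} → C ⊢ a ∶ nam ν → C ⊢ b ∶ nam ν → C ⊢ x ∶ τ →
         Ax C (a # x ∷ b # x ∷ []) (sw a b x ≈ x ∷ [])
    F2 : ∀ {a b ν ν'} → C ⊢ a ∶ nam ν → C ⊢ b ∶ nam ν' → ν ≢ ν' →
         Ax C [] (a # b ∷ [])
    F3 : ∀ {a ν} → C ⊢ a ∶ nam ν →
         Ax C (a # a ∷ []) []
    F4 : ∀ {a b ν} → C ⊢ a ∶ nam ν → C ⊢ b ∶ nam ν →
         Ax C [] (a # b ∷ a ≈ b ∷ [])
    A1 : ∀ {a b x y ν τ} → C ⊢ a ∶ nam ν → C ⊢ b ∶ nam ν →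
         C ⊢ x ∶ τ → C ⊢ y ∶ τ →
         Ax C (a # y ∷ x ≈ sw a b y ∷ []) (abst a x ≈ abst b y ∷ [])

  -- Derivations of NL⇒.  Sequents Σ;Γ ⇒ Δ with Γ, Δ multisets, represented
  -- as lists together with an exchange rule 'perm' (not counted in height).
  -- "Γ,φ" is written φ ∷ Γ.

  data Der : Ctx → List Fm → List Fm → Set where
    perm : ∀ {C Γ Γ' Δ Δ'} → Γ ↭ Γ' → Δ ↭ Δ' → Der C Γ Δ → Der C Γ' Δ'
    hyp  : ∀ {C Γ Δ P} → Atomic P → Der C (P ∷ Γ) (P ∷ Δ)
    ⊤R   : ∀ {C Γ Δ} → Der C Γ (⊤f ∷ Δ)
    ⊥L   : ∀ {C Γ Δ} → Der C (⊥f ∷ Γ) Δ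
    ∧L   : ∀ {C Γ Δ φ ψ} → Der C (φ ∷ ψ ∷ Γ) Δ → Der C (φ ∧f ψ ∷ Γ) Δ
    ∧R   : ∀ {C Γ Δ φ ψ} → Der C Γ (φ ∷ Δ) → Der C Γ (ψ ∷ Δ) →
           Der C Γ (φ ∧f ψ ∷ Δ)
    ∨L   : ∀ {C Γ Δ φ ψ} → Der C (φ ∷ Γ) Δ → Der C (ψ ∷ Γ) Δ →
           Der C (φ ∨f ψ ∷ Γ) Δ
    ∨R   : ∀ {C Γ Δ φ ψ} → Der C Γ (φ ∷ ψ ∷ Δ) → Der C Γ (φ ∨f ψ ∷ Δ)
    ⊃L   : ∀ {C Γ Δ φ ψ} → Der C Γ (φ ∷ Δ) → Der C (ψ ∷ Γ) Δ →
           Der C (φ ⊃f ψ ∷ Γ) Δ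
    ⊃R   : ∀ {C Γ Δ φ ψ} → Der C (φ ∷ Γ) (ψ ∷ Δ) → Der C Γ (φ ⊃f ψ ∷ Δ)
    ∀L   : ∀ {C Γ Δ τ φ t} → C ⊢ t ∶ τ →
           Der C (inst φ t ∷ ∀f τ φ ∷ Γ) Δ → Der C (∀f τ φ ∷ Γ) Δ
    ∀R   : ∀ {C Γ Δ τ φ} →
           Der (C ,v τ) (map wkVF Γ) (φ ∷ map wkVF Δ) → Der C Γ (∀f τ φ ∷ Δ)
    ∃L   : ∀ {C Γ Δ τ φ} →
           Der (C ,v τ) (φ ∷ map wkVF Γ) (map wkVF Δ) → Der C (∃f τ φ ∷ Γ) Δ
    ∃R   : ∀ {C Γ Δ τ φ t} → C ⊢ t ∶ τ →
           Der C Γ (inst φ t ∷ ∃f τ φ ∷ Δ) → Der C Γ (∃f τ φ ∷ Δ)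
    ИR   : ∀ {C Γ Δ ν φ} →
           Der (C #n ν) (map wkNF Γ) (φ ∷ map wkNF Δ) → Der C Γ (Иf ν φ ∷ Δ)
    ИL   : ∀ {C Γ Δ ν φ} →
           Der (C #n ν) (φ ∷ map wkNF Γ) (map wkNF Δ) → Der C (Иf ν φ ∷ Γ) Δ
    ≈R   : ∀ {C Γ Δ t τ} → C ⊢ t ∶ τ → Der C (t ≈ t ∷ Γ) Δ → Der C Γ Δ
    ≈S   : ∀ {C Γ Δ t u P} → Atomic P →
           Der C (t ≈ u ∷ inst P t ∷ inst P u ∷ Γ) Δ →
           Der C (t ≈ u ∷ inst P t ∷ Γ) Δ
    ax   : ∀ {C Γ Δ Ps Qs} → Ax C Ps Qs →
           All (λ Q → Der C (Q ∷ Ps ++ Γ) Δ) Qs → Der C (Ps ++ Γ) Δ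
    A2   : ∀ {C Γ Δ a b t u} →
           Der C (abst a t ≈ abst b u ∷ a ≈ b ∷ t ≈ u ∷ Γ) Δ →
           Der C (abst a t ≈ abst b u ∷ a # u ∷ t ≈ sw a b u ∷ Γ) Δ →
           Der C (abst a t ≈ abst b u ∷ Γ) Δ
    A3   : ∀ {C Γ Δ t ν σ} → C ⊢ t ∶ abs ν σ →
           Der (C ,v nam ν ,v σ)
               (wkV (wkV t) ≈ abst (var 1) (var 0) ∷ map (λ φ → wkVF (wkVF φ)) Γ)
               (map (λ φ → wkVF (wkVF φ)) Δ) →
           Der C Γ Δ
    F    : ∀ {C Γ Δ ν} → Der (C #n ν) (map wkNF Γ) (map wkNF Δ) → Der C Γ Δ
    Σ#   : ∀ {C Γ Δ φ} → C ∋# φ → Der C (φ ∷ Γ) Δ → Der C Γ Δ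

  mutual
    lh : ∀ {C Γ Δ} → Der C Γ Δ → ℕ
    lh (perm _ _ d) = lh d
    lh (hyp _)      = 1
    lh ⊤R           = 1
    lh ⊥L           = 1
    lh (∧L d)       = suc (lh d)
    lh (∧R d e)     = suc (lh d ⊔ lh e)
    lh (∨L d e)     = suc (lh d ⊔ lh e)
    lh (∨R d)       = suc (lh d)
    lh (⊃L d e)     = suc (lh d ⊔ lh e)
    lh (⊃R d)       = suc (lh d)
    lh (∀L _ d)     = suc (lh d)
    lh (∀R d)       = suc (lh d)
    lh (∃L d)       = suc (lh d)
    lh (∃R _ d)     = suc (lh d)
    lh (ИR d)       = suc (lh d)
    lh (ИL d)       = suc (lh d)
    lh (≈R _ d)     = lh d
    lh (≈S _ d)     = lh d
    lh (ax _ ds)    = lhAll ds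
    lh (A2 d e)     = lh d ⊔ lh e
    lh (A3 _ d)     = lh d
    lh (F d)        = lh d
    lh (Σ# _ d)     = lh d

    lhAll : ∀ {C Γ Δ Qs} → All (λ Q → Der C (Q ∷ Γ) Δ) Qs → ℕ
    lhAll []       = 0
    lhAll (d ∷ ds) = lh d ⊔ lhAll ds

-- Induction on the derivation of Σ;Γ' ⇒ Δ', where each formula of Γ' and Δ'
-- is either a formula of the target sequent Σ;Γ ⇒ Δ or the swap of one;
-- every rule is then mirrored by the same rule on the unswapped formulas.
-- Two places need the nonlogical axioms, neither of which counts towards
-- the logical height: a swapped atom on the left is traded for the
-- original atom as soon as it appears, by one E3 step, and an initial
-- sequent (a b)·P ⇒ P is derived from E3 followed by rewriting every
-- argument (a b)·(a b)·t back to t with S2 and ≈S.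

module Submission where

open import Defs
open import Data.Nat using (ℕ; suc; _⊔_)
open import Data.Nat.Properties using (⊔-identityʳ)
open import Data.List using (List; []; _∷_; _++_; map)
open import Data.List.Properties using (map-++; ++-assoc; ++-identityʳ)
open import Data.List.Relation.Unary.All using (All; []; _∷_)
import Data.List.Relation.Binary.Pointwise as Pointwise
open import Data.List.Relation.Binary.Pointwise using (Pointwise; []; _∷_)
import Data.List.Relation.Binary.Permutation.Propositional as ↭
open import Data.List.Relation.Binary.Permutation.Propositional
  using (_↭_; ↭-refl; ↭-sym; ↭-trans; ↭-reflexive)
open import Data.List.Relation.Binary.Permutation.Propositional.Properties
  using (shift; ++⁺ʳ; map⁺)
open import Data.Product using (Σ-syntax; _×_; _,_; proj₂)
open import Data.Sum using (_⊎_; inj₁; inj₂)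
open import Data.Unit using (⊤; tt)
open import Relation.Binary.PropositionalEquality
  using (_≡_; refl; sym; trans; cong; cong₂)

module SwapAdmissibility (𝕊 : Sig) where
  open Sig 𝕊
  open NL 𝕊

  private variable
    C C' : Ctx
    a b t u : Tm
    ts : List Tm
    p : PSym
    ν : NTy
    τ : Type
    τs : List Type
    σ : ℕ → Tm
    ρ : ℕ → ℕ
    x x' φ ψ χ : Fm
    Γ Γ' Γ'' Δ Δ' Δ'' Θ' Ps Qs : List Fm

  mutual
    sub-∘ : ∀ σ ρ σ' ρ' t →
      sub σ ρ (sub σ' ρ' t) ≡ sub (λ i → sub σ ρ (σ' i)) (λ i → ρ (ρ' i)) t
    sub-∘ σ ρ σ' ρ' (var i)   = refl
    sub-∘ σ ρ σ' ρ' (nm i)    = refl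
    sub-∘ σ ρ σ' ρ' (con c)   = refl
    sub-∘ σ ρ σ' ρ' (fn f ts) = cong (fn f) (subs-∘ σ ρ σ' ρ' ts)

    subs-∘ : ∀ σ ρ σ' ρ' ts →
      subs σ ρ (subs σ' ρ' ts) ≡ subs (λ i → sub σ ρ (σ' i)) (λ i → ρ (ρ' i)) ts
    subs-∘ σ ρ σ' ρ' []       = refl
    subs-∘ σ ρ σ' ρ' (t ∷ ts) = cong₂ _∷_ (sub-∘ σ ρ σ' ρ' t) (subs-∘ σ ρ σ' ρ' ts)

  mutual
    sub-id : ∀ t → sub var (λ i → i) t ≡ t
    sub-id (var i)   = refl
    sub-id (nm i)    = refl
    sub-id (con c)   = refl
    sub-id (fn f ts) = cong (fn f) (subs-id ts)

    subs-id : ∀ ts → subs var (λ i → i) ts ≡ ts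
    subs-id []       = refl
    subs-id (t ∷ ts) = cong₂ _∷_ (sub-id t) (subs-id ts)

  sub-single-wkV : ∀ t u → sub (single t) (λ i → i) (wkV u) ≡ u
  sub-single-wkV t u = trans (sub-∘ (single t) (λ i → i) _ _ u) (sub-id u)

  sub-liftV-wkV : ∀ σ ρ t → sub (liftV σ) ρ (wkV t) ≡ wkV (sub σ ρ t)
  sub-liftV-wkV σ ρ t =
    trans (sub-∘ (liftV σ) ρ _ _ t) (sym (sub-∘ (λ i → var (suc i)) (λ i → i) σ ρ t))

  sub-liftN-wkN : ∀ σ ρ t → sub (λ i → wkN (σ i)) (liftN ρ) (wkN t) ≡ wkN (sub σ ρ t)
  sub-liftN-wkN σ ρ t =
    trans (sub-∘ (λ i → wkN (σ i)) (liftN ρ) var suc t) (sym (sub-∘ var suc σ ρ t))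

  subs-single-wkV : ∀ t ys → subs (single t) (λ i → i) (map wkV ys) ≡ ys
  subs-single-wkV t []       = refl
  subs-single-wkV t (y ∷ ys) = cong₂ _∷_ (sub-single-wkV t y) (subs-single-wkV t ys)

  subs-single-hole : ∀ t xs ys →
    subs (single t) (λ i → i) (map wkV xs ++ var 0 ∷ map wkV ys) ≡ xs ++ t ∷ ys
  subs-single-hole t []       ys = cong (t ∷_) (subs-single-wkV t ys)
  subs-single-hole t (x ∷ xs) ys = cong₂ _∷_ (sub-single-wkV t x) (subs-single-hole t xs ys)

  subs-map-sw : ∀ σ ρ a b ts →
    subs σ ρ (map (sw a b) ts) ≡ map (sw (sub σ ρ a) (sub σ ρ b)) (subs σ ρ ts)
  subs-map-sw σ ρ a b []       = refl
  subs-map-sw σ ρ a b (t ∷ ts) = cong (_ ∷_) (subs-map-sw σ ρ a b ts)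

  subF-swapF : ∀ σ ρ a b φ →
    subF σ ρ (swapF a b φ) ≡ swapF (sub σ ρ a) (sub σ ρ b) (subF σ ρ φ)
  subF-swapF σ ρ a b ⊤f          = refl
  subF-swapF σ ρ a b ⊥f          = refl
  subF-swapF σ ρ a b (atom p ts) = cong (atom p) (subs-map-sw σ ρ a b ts)
  subF-swapF σ ρ a b (φ ∧f ψ)    = cong₂ _∧f_ (subF-swapF σ ρ a b φ) (subF-swapF σ ρ a b ψ)
  subF-swapF σ ρ a b (φ ∨f ψ)    = cong₂ _∨f_ (subF-swapF σ ρ a b φ) (subF-swapF σ ρ a b ψ)
  subF-swapF σ ρ a b (φ ⊃f ψ)    = cong₂ _⊃f_ (subF-swapF σ ρ a b φ) (subF-swapF σ ρ a b ψ)
  subF-swapF σ ρ a b (∀f τ φ)    = cong (∀f τ) (trans (subF-swapF (liftV σ) ρ (wkV a) (wkV b) φ)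
    (cong₂ (λ a' b' → swapF a' b' _) (sub-liftV-wkV σ ρ a) (sub-liftV-wkV σ ρ b)))
  subF-swapF σ ρ a b (∃f τ φ)    = cong (∃f τ) (trans (subF-swapF (liftV σ) ρ (wkV a) (wkV b) φ)
    (cong₂ (λ a' b' → swapF a' b' _) (sub-liftV-wkV σ ρ a) (sub-liftV-wkV σ ρ b)))
  subF-swapF σ ρ a b (Иf ν φ)    = cong (Иf ν) (trans (subF-swapF _ (liftN ρ) (wkN a) (wkN b) φ)
    (cong₂ (λ a' b' → swapF a' b' _) (sub-liftN-wkN σ ρ a) (sub-liftN-wkN σ ρ b)))

  inst-swapF : ∀ a b φ t → inst (swapF (wkV a) (wkV b) φ) t ≡ swapF a b (inst φ t)
  inst-swapF a b φ t = trans (subF-swapF (single t) (λ i → i) (wkV a) (wkV b) φ)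
    (cong₂ (λ a' b' → swapF a' b' _) (sub-single-wkV t a) (sub-single-wkV t b))

  record TypedSub (C' C : Ctx) (σ : ℕ → Tm) (ρ : ℕ → ℕ) : Set where
    field
      typed-var : ∀ {i τ} → C' ∋v i ∶ τ → C ⊢ σ i ∶ τ
      typed-nm  : ∀ {i ν} → C' ∋n i ∶ ν → C ∋n ρ i ∶ ν
  open TypedSub

  mutual
    sub-typed : TypedSub C' C σ ρ → C' ⊢ t ∶ τ → C ⊢ sub σ ρ t ∶ τ
    sub-typed s (var x)     = typed-var s x
    sub-typed s (nm x)      = nm (typed-nm s x)
    sub-typed s (con c)     = con c
    sub-typed s (swp p q r) = swp (sub-typed s p) (sub-typed s q) (sub-typed s r)
    sub-typed s (ab p q)    = ab (sub-typed s p) (sub-typed s q)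
    sub-typed s (usr ps)    = usr (subs-typed s ps)

    subs-typed : TypedSub C' C σ ρ → C' ⊢* ts ∶ τs → C ⊢* subs σ ρ ts ∶ τs
    subs-typed s []       = []
    subs-typed s (p ∷ ps) = sub-typed s p ∷ subs-typed s ps

  wkV-typed : TypedSub C (C ,v τ) (λ i → var (suc i)) (λ i → i)
  wkV-typed = record { typed-var = λ x → var (there x) ; typed-nm = skip }

  wkN-typed : TypedSub C (C #n ν) var suc
  wkN-typed = record { typed-var = λ x → var (skip x) ; typed-nm = there }

  wkV-⊢ : ∀ {υ} → C ⊢ t ∶ τ → C ,v υ ⊢ wkV t ∶ τ
  wkV-⊢ = sub-typed wkV-typed

  wkN-⊢ : C ⊢ t ∶ τ → C #n ν ⊢ wkN t ∶ τ
  wkN-⊢ = sub-typed wkN-typed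

  single-typed : C ⊢ t ∶ τ → TypedSub (C ,v τ) C (single t) (λ i → i)
  single-typed p = record
    { typed-var = λ { here → p ; (there x) → var x }
    ; typed-nm  = λ { (skip x) → x } }

  liftV-typed : TypedSub C' C σ ρ → TypedSub (C' ,v τ) (C ,v τ) (liftV σ) ρ
  liftV-typed s = record
    { typed-var = λ { here → var here ; (there x) → sub-typed wkV-typed (typed-var s x) }
    ; typed-nm  = λ { (skip x) → skip (typed-nm s x) } }

  liftN-typed : TypedSub C' C σ ρ →
    TypedSub (C' #n ν) (C #n ν) (λ i → wkN (σ i)) (liftN ρ)
  liftN-typed s = record
    { typed-var = λ { (skip x) → sub-typed wkN-typed (typed-var s x) }
    ; typed-nm  = λ { here → here ; (there x) → there (typed-nm s x) } }

  subF-wf : TypedSub C' C σ ρ → C' ⊢ φ wf → C ⊢ subF σ ρ φ wf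
  subF-wf s ⊤f        = ⊤f
  subF-wf s ⊥f        = ⊥f
  subF-wf s (eq p q)  = eq (sub-typed s p) (sub-typed s q)
  subF-wf s (fr p q)  = fr (sub-typed s p) (sub-typed s q)
  subF-wf s (rel ps)  = rel (subs-typed s ps)
  subF-wf s (and p q) = and (subF-wf s p) (subF-wf s q)
  subF-wf s (or p q)  = or (subF-wf s p) (subF-wf s q)
  subF-wf s (imp p q) = imp (subF-wf s p) (subF-wf s q)
  subF-wf s (all p)   = all (subF-wf (liftV-typed s) p)
  subF-wf s (ex p)    = ex (subF-wf (liftV-typed s) p)
  subF-wf s (new p)   = new (subF-wf (liftN-typed s) p)

  data Compound : Fm → Set where
    ⊤f    : Compound ⊤f
    ⊥f    : Compound ⊥f
    _∧f_  : ∀ φ ψ → Compound (φ ∧f ψ)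
    _∨f_  : ∀ φ ψ → Compound (φ ∨f ψ)
    _⊃f_  : ∀ φ ψ → Compound (φ ⊃f ψ)
    ∀f    : ∀ τ φ → Compound (∀f τ φ)
    ∃f    : ∀ τ φ → Compound (∃f τ φ)
    Иf    : ∀ ν φ → Compound (Иf ν φ)

  atomic-or-compound : ∀ φ → Atomic φ ⊎ Compound φ
  atomic-or-compound ⊤f          = inj₂ ⊤f
  atomic-or-compound ⊥f          = inj₂ ⊥f
  atomic-or-compound (atom p ts) = inj₁ (atom p ts)
  atomic-or-compound (φ ∧f ψ)    = inj₂ (φ ∧f ψ)
  atomic-or-compound (φ ∨f ψ)    = inj₂ (φ ∨f ψ)
  atomic-or-compound (φ ⊃f ψ)    = inj₂ (φ ⊃f ψ)
  atomic-or-compound (∀f τ φ)    = inj₂ (∀f τ φ)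
  atomic-or-compound (∃f τ φ)    = inj₂ (∃f τ φ)
  atomic-or-compound (Иf ν φ)    = inj₂ (Иf ν φ)

  subF-compound : Compound φ → Compound (subF σ ρ φ)
  subF-compound ⊤f       = ⊤f
  subF-compound ⊥f       = ⊥f
  subF-compound (φ ∧f ψ) = _ ∧f _
  subF-compound (φ ∨f ψ) = _ ∨f _
  subF-compound (φ ⊃f ψ) = _ ⊃f _
  subF-compound (∀f τ φ) = ∀f τ _
  subF-compound (∃f τ φ) = ∃f τ _
  subF-compound (Иf ν φ) = Иf ν _

  subF-atomic : Atomic φ → Atomic (subF σ ρ φ)
  subF-atomic (atom p ts) = atom p _

  swapped-args-typed : C ⊢ a ∶ nam ν → C ⊢ b ∶ nam ν →
    C ⊢* ts ∶ τs → C ⊢* map (sw a b) ts ∶ τs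
  swapped-args-typed ta tb []       = []
  swapped-args-typed ta tb (p ∷ ps) = swp ta tb p ∷ swapped-args-typed ta tb ps

  swapped-atom-wf : C ⊢ a ∶ nam ν → C ⊢ b ∶ nam ν →
    C ⊢ atom p ts wf → C ⊢ swapF a b (atom p ts) wf
  swapped-atom-wf ta tb (eq p q) = eq (swp ta tb p) (swp ta tb q)
  swapped-atom-wf ta tb (fr p q) = fr (swp ta tb p) (swp ta tb q)
  swapped-atom-wf ta tb (rel ps) = rel (swapped-args-typed ta tb ps)

  atom-args-typed : C ⊢ atom p ts wf → Σ[ τs ∈ List Type ] C ⊢* ts ∶ τs
  atom-args-typed (eq p q) = _ , p ∷ q ∷ []
  atom-args-typed (fr p q) = _ , p ∷ q ∷ []
  atom-args-typed (rel ps) = _ , ps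

  ≈S-arg : ∀ xs ys →
    Der C (atom p (xs ++ u ∷ ys) ∷ t ≈ u ∷ atom p (xs ++ t ∷ ys) ∷ Γ) Δ →
    Der C (t ≈ u ∷ atom p (xs ++ t ∷ ys) ∷ Γ) Δ
  ≈S-arg {p = p} {u = u} {t = t} {Γ = Γ} xs ys d =
    perm (↭-reflexive (cong (λ A → t ≈ u ∷ A ∷ Γ) (fill t))) ↭-refl
         (≈S (atom p hole) (perm reorder ↭-refl d))
    where
    hole : List Tm
    hole = map wkV xs ++ var 0 ∷ map wkV ys

    fill : ∀ s → inst (atom p hole) s ≡ atom p (xs ++ s ∷ ys)
    fill s = cong (atom p) (subs-single-hole s xs ys)

    reorder : atom p (xs ++ u ∷ ys) ∷ t ≈ u ∷ atom p (xs ++ t ∷ ys) ∷ Γ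
            ↭ t ≈ u ∷ inst (atom p hole) t ∷ inst (atom p hole) u ∷ Γ
    reorder = ↭-trans (↭-sym (shift _ (t ≈ u ∷ atom p (xs ++ t ∷ ys) ∷ []) Γ))
                      (↭-reflexive (cong₂ (λ A B → t ≈ u ∷ A ∷ B ∷ Γ) (sym (fill t)) (sym (fill u))))

  swap²-args⇒args : ∀ xs ys → C ⊢ a ∶ nam ν → C ⊢ b ∶ nam ν → C ⊢* ys ∶ τs →
    Σ[ d ∈ Der C (atom p (xs ++ map (sw a b) (map (sw a b) ys)) ∷ Γ)
                 (atom p (xs ++ ys) ∷ Δ) ] lh d ≡ 1
  swap²-args⇒args xs [] ta tb [] = hyp (atom _ _) , refl
  swap²-args⇒args {a = a} {b = b} {p = p} {Δ = Δ} xs (y ∷ ys) ta tb (ty ∷ tys) =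
    let (d , lh-d) = swap²-args⇒args {p = p} (xs ++ y ∷ []) ys ta tb tys
    in ax (S2 ta tb ty) (≈S-arg xs _ (perm (reassoc _ ys²) (reassoc Δ ys) d) ∷ [])
       , trans (⊔-identityʳ (lh d)) lh-d
    where
    ys² : List Tm
    ys² = map (sw a b) (map (sw a b) ys)

    reassoc : ∀ Θ zs → atom p ((xs ++ y ∷ []) ++ zs) ∷ Θ ↭ atom p (xs ++ y ∷ zs) ∷ Θ
    reassoc Θ zs = ↭-reflexive (cong (λ ws → atom p ws ∷ Θ) (++-assoc xs (y ∷ []) zs))

  swapped-atom⇒atom : C ⊢ a ∶ nam ν → C ⊢ b ∶ nam ν → C ⊢ atom p ts wf →
    Σ[ d ∈ Der C (swapF a b (atom p ts) ∷ Γ) (atom p ts ∷ Δ) ] lh d ≡ 1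
  swapped-atom⇒atom ta tb w =
    let (d , lh-d) = swap²-args⇒args [] _ ta tb (proj₂ (atom-args-typed w))
    in ax (E3 ta tb (swapped-atom-wf ta tb w)) (d ∷ []) , trans (⊔-identityʳ (lh d)) lh-d

  data SwapView (a b : Tm) : Fm → Fm → Set where
    ⊤f   : SwapView a b ⊤f ⊤f
    ⊥f   : SwapView a b ⊥f ⊥f
    atom : SwapView a b (atom p (map (sw a b) ts)) (atom p ts)
    _∧f_ : ∀ φ ψ → SwapView a b (swapF a b φ ∧f swapF a b ψ) (φ ∧f ψ)
    _∨f_ : ∀ φ ψ → SwapView a b (swapF a b φ ∨f swapF a b ψ) (φ ∨f ψ)
    _⊃f_ : ∀ φ ψ → SwapView a b (swapF a b φ ⊃f swapF a b ψ) (φ ⊃f ψ)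
    ∀f   : ∀ τ φ → SwapView a b (∀f τ (swapF (wkV a) (wkV b) φ)) (∀f τ φ)
    ∃f   : ∀ τ φ → SwapView a b (∃f τ (swapF (wkV a) (wkV b) φ)) (∃f τ φ)
    Иf   : ∀ ν φ → SwapView a b (Иf ν (swapF (wkN a) (wkN b) φ)) (Иf ν φ)

  swapView : x' ≡ swapF a b x → SwapView a b x' x
  swapView {x = ⊤f}        refl = ⊤f
  swapView {x = ⊥f}        refl = ⊥f
  swapView {x = atom p ts} refl = atom
  swapView {x = φ ∧f ψ}    refl = φ ∧f ψ
  swapView {x = φ ∨f ψ}    refl = φ ∨f ψ
  swapView {x = φ ⊃f ψ}    refl = φ ⊃f ψ
  swapView {x = ∀f τ φ}    refl = ∀f τ φ
  swapView {x = ∃f τ φ}    refl = ∃f τ φ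
  swapView {x = Иf ν φ}    refl = Иf ν φ

  swapView⁻¹ : SwapView a b x' x → x' ≡ swapF a b x
  swapView⁻¹ ⊤f       = refl
  swapView⁻¹ ⊥f       = refl
  swapView⁻¹ atom     = refl
  swapView⁻¹ (φ ∧f ψ) = refl
  swapView⁻¹ (φ ∨f ψ) = refl
  swapView⁻¹ (φ ⊃f ψ) = refl
  swapView⁻¹ (∀f τ φ) = refl
  swapView⁻¹ (∃f τ φ) = refl
  swapView⁻¹ (Иf ν φ) = refl

  -- x' in the given derivation stands for x in the target sequent.  On the left
  -- only compound formulas stay swapped (introˡ trades swapped atoms at once),
  -- so every atom that a rule consumes on the left is unchanged.
  data Unswap (K : Fm → Set) (a b : Tm) (C : Ctx) : Fm → Fm → Set where
    same    : Unswap K a b C x x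
    swapped : SwapView a b x' x → C ⊢ x wf → K x → Unswap K a b C x' x

  Unswapˡ Unswapʳ : Tm → Tm → Ctx → Fm → Fm → Set
  Unswapˡ = Unswap Compound
  Unswapʳ = Unswap (λ _ → ⊤)

  unswap-sub : ∀ {K} → (∀ {x} → K x → K (subF σ ρ x)) → TypedSub C C' σ ρ →
    Unswap K a b C x' x → Unswap K (sub σ ρ a) (sub σ ρ b) C' (subF σ ρ x') (subF σ ρ x)
  unswap-sub k s same = same
  unswap-sub {σ = σ} {ρ = ρ} {a = a} {b = b} k s (swapped v w c) =
    swapped (swapView (trans (cong (subF σ ρ) (swapView⁻¹ v)) (subF-swapF σ ρ a b _)))
            (subF-wf s w) (k c)

  unswapˡ-sub : TypedSub C C' σ ρ → Unswapˡ a b C x' x →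
    Unswapˡ (sub σ ρ a) (sub σ ρ b) C' (subF σ ρ x') (subF σ ρ x)
  unswapˡ-sub = unswap-sub subF-compound

  unswapʳ-sub : TypedSub C C' σ ρ → Unswapʳ a b C x' x →
    Unswapʳ (sub σ ρ a) (sub σ ρ b) C' (subF σ ρ x') (subF σ ρ x)
  unswapʳ-sub = unswap-sub (λ _ → tt)

  unswapˡ-atomic : Atomic x' → Unswapˡ a b C x' x → x ≡ x'
  unswapˡ-atomic _           same                = refl
  unswapˡ-atomic (atom p ts) (swapped atom w ())

  -- Γ contains, up to permutation, a pointwise E-image of Γ' (and possibly more).
  record Related (E : Fm → Fm → Set) (Γ' Γ : List Fm) : Set where
    constructor related
    field
      {image rest} : List Fm
      pointwise    : Pointwise E Γ' image
      split        : Γ ↭ image ++ rest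

  record Uncons (E : Fm → Fm → Set) (x' : Fm) (Γ' Γ : List Fm) : Set where
    constructor uncons
    field
      {x₀}         : Fm
      {Γ₀}         : List Fm
      related-head : E x' x₀
      related-tail : Related E Γ' Γ₀
      split-head   : Γ ↭ x₀ ∷ Γ₀

  module _ {E : Fm → Fm → Set} where

    infixr 5 _∷ᴿ_
    _∷ᴿ_ : E x' x → Related E Γ' Γ → Related E (x' ∷ Γ') (x ∷ Γ)
    e ∷ᴿ related pw pr = related (e ∷ pw) (↭.prep _ pr)

    Related-uncons : Related E (x' ∷ Γ') Γ → Uncons E x' Γ' Γ
    Related-uncons (related (e ∷ pw) pr) = uncons e (related pw ↭-refl) pr

    Related-weaken : Related E Γ' Γ → Related E Γ' (x ∷ Γ)
    Related-weaken {x = x} (related {image} {rest} pw pr) =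
      related pw (↭-trans (↭.prep x pr) (↭-sym (shift x image rest)))

    pointwise-↭ : ∀ {image} → Γ'' ↭ Γ' → Pointwise E Γ' image →
      Σ[ image' ∈ List Fm ] Pointwise E Γ'' image' × image' ↭ image
    pointwise-↭ ↭.refl pw = _ , pw , ↭-refl
    pointwise-↭ (↭.prep _ p) (e ∷ pw) =
      let (_ , pw' , q) = pointwise-↭ p pw in _ , e ∷ pw' , ↭.prep _ q
    pointwise-↭ (↭.swap _ _ p) (e₁ ∷ e₂ ∷ pw) =
      let (_ , pw' , q) = pointwise-↭ p pw in _ , e₂ ∷ e₁ ∷ pw' , ↭.swap _ _ q
    pointwise-↭ (↭.trans p₁ p₂) pw =
      let (_ , pw₂ , q₂) = pointwise-↭ p₂ pw
          (_ , pw₁ , q₁) = pointwise-↭ p₁ pw₂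
      in _ , pw₁ , ↭-trans q₁ q₂

    Related-↭ : Γ'' ↭ Γ' → Related E Γ' Γ → Related E Γ'' Γ
    Related-↭ p (related {rest = rest} pw pr) =
      let (_ , pw' , q) = pointwise-↭ p pw
      in related pw' (↭-trans pr (↭-sym (++⁺ʳ rest q)))

    Related-map : ∀ {E'} (f : Fm → Fm) → (∀ {x' x} → E x' x → E' (f x') (f x)) →
      Related E Γ' Γ → Related E' (map f Γ') (map f Γ)
    Related-map f g (related {image} {rest} pw pr) =
      related (Pointwise.map⁺ f f (Pointwise.map g pw))
              (↭-trans (map⁺ f pr) (↭-reflexive (map-++ f image rest)))

  module _ {K : Fm → Set} where

    Related-refl : ∀ Γ → Related (Unswap K a b C) Γ Γ
    Related-refl Γ =
      related {rest = []} (Pointwise.refl same) (↭-reflexive (sym (++-identityʳ Γ)))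

    Related-++ : ∀ Ps → Related (Unswap K a b C) Γ' Γ →
      Related (Unswap K a b C) (Ps ++ Γ') (Ps ++ Γ)
    Related-++ []       r = r
    Related-++ (_ ∷ Ps) r = same ∷ᴿ Related-++ Ps r

  Relatedˡ Relatedʳ : Tm → Tm → Ctx → List Fm → List Fm → Set
  Relatedˡ a b C = Related (Unswapˡ a b C)
  Relatedʳ a b C = Related (Unswapʳ a b C)

  uncons-atoms : All Atomic Ps → Relatedˡ a b C (Ps ++ Γ') Γ →
    Σ[ Γ₀ ∈ List Fm ] Relatedˡ a b C Γ' Γ₀ × Γ ↭ Ps ++ Γ₀
  uncons-atoms []         r = _ , r , ↭-refl
  uncons-atoms (at ∷ ats) r with Related-uncons r
  ... | uncons e r' p with unswapˡ-atomic at e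
  ... | refl = let (Γ₀ , r₀ , p₀) = uncons-atoms ats r'
               in Γ₀ , r₀ , ↭-trans p (↭.prep _ p₀)

  ax-premises-atomic : Ax C Ps Qs → All Atomic Ps
  ax-premises-atomic (S1 _ _)     = []
  ax-premises-atomic (S2 _ _ _)   = []
  ax-premises-atomic (S3 _ _)     = []
  ax-premises-atomic (E1 _ _ _)   = []
  ax-premises-atomic (E2 _ _ _)   = []
  ax-premises-atomic (E3 _ _ _)   = atom _ _ ∷ []
  ax-premises-atomic (F1 _ _ _)   = atom _ _ ∷ atom _ _ ∷ []
  ax-premises-atomic (F2 _ _ _)   = []
  ax-premises-atomic (F3 _)       = atom _ _ ∷ []
  ax-premises-atomic (F4 _ _)     = []
  ax-premises-atomic (A1 _ _ _ _) = atom _ _ ∷ atom _ _ ∷ []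

  Replaceable : Ctx → List Fm → List Fm → Set
  Replaceable C Γ₁ Γ₂ = ∀ {Δ} Θ → (d : Der C (Θ ++ Γ₁) Δ) →
    Σ[ d' ∈ Der C (Θ ++ Γ₂) Δ ] lh d' ≡ lh d

  drop-swapped-atom : C ⊢ a ∶ nam ν → C ⊢ b ∶ nam ν → C ⊢ atom p ts wf →
    Replaceable C (swapF a b (atom p ts) ∷ atom p ts ∷ Γ) (atom p ts ∷ Γ)
  drop-swapped-atom {a = a} {b = b} {p = p} {ts = ts} {Γ = Γ} ta tb w Θ d =
    perm (↭-sym (shift P Θ Γ)) ↭-refl
         (ax (E3 ta tb w)
             (perm (↭-trans (shift P' Θ (P ∷ Γ)) (↭.prep P' (shift P Θ Γ))) ↭-refl d ∷ []))
    , ⊔-identityʳ (lh d)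
    where
    P P' : Fm
    P  = atom p ts
    P' = swapF a b P

  -- A swapped atom is traded for the atom itself, with the swapped copy kept
  -- alongside; a compound formula is simply recorded as swapped.
  introˡ : C ⊢ a ∶ nam ν → C ⊢ b ∶ nam ν → C ⊢ χ wf → x' ≡ swapF a b χ →
    Relatedˡ a b C Γ' Γ →
    Σ[ Γ₁ ∈ List Fm ] Relatedˡ a b C (x' ∷ Γ') Γ₁ × Replaceable C Γ₁ (χ ∷ Γ)
  introˡ {χ = χ} ta tb w x'≡ r with atomic-or-compound χ
  introˡ ta tb w refl r | inj₁ (atom p ts) =
    _ , same ∷ᴿ Related-weaken r , drop-swapped-atom ta tb w
  introˡ ta tb w x'≡ r  | inj₂ c =
    _ , swapped (swapView x'≡) w c ∷ᴿ r , λ Θ d → d , refl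

  unswapʳ-swapF : C ⊢ χ wf → Unswapʳ a b C (swapF a b χ) χ
  unswapʳ-swapF w = swapped (swapView refl) w tt

  Unswaps : ∀ {C Γ' Δ'} → Tm → Tm → Der C Γ' Δ' → Set
  Unswaps {C} {Γ'} {Δ'} a b d = ∀ {Γ Δ} → Relatedˡ a b C Γ' Γ → Relatedʳ a b C Δ' Δ →
    Σ[ d' ∈ Der C Γ Δ ] lh d' ≡ lh d

  UnswapsAll : ∀ {C Θ' Δ' Qs} → Tm → Tm → All (λ Q → Der C (Q ∷ Θ') Δ') Qs → Set
  UnswapsAll {C} {Θ'} {Δ'} {Qs} a b ds = ∀ {Θ Δ} → Relatedˡ a b C Θ' Θ → Relatedʳ a b C Δ' Δ →
    Σ[ ds' ∈ All (λ Q → Der C (Q ∷ Θ) Δ) Qs ] lhAll ds' ≡ lhAll ds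

  weakenVˡ : Relatedˡ a b C Γ' Γ →
    Relatedˡ (wkV a) (wkV b) (C ,v τ) (map wkVF Γ') (map wkVF Γ)
  weakenVˡ = Related-map wkVF (unswapˡ-sub wkV-typed)

  weakenVʳ : Relatedʳ a b C Δ' Δ →
    Relatedʳ (wkV a) (wkV b) (C ,v τ) (map wkVF Δ') (map wkVF Δ)
  weakenVʳ = Related-map wkVF (unswapʳ-sub wkV-typed)

  weakenNˡ : Relatedˡ a b C Γ' Γ →
    Relatedˡ (wkN a) (wkN b) (C #n ν) (map wkNF Γ') (map wkNF Γ)
  weakenNˡ = Related-map wkNF (unswapˡ-sub wkN-typed)

  weakenNʳ : Relatedʳ a b C Δ' Δ →
    Relatedʳ (wkN a) (wkN b) (C #n ν) (map wkNF Δ') (map wkNF Δ)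
  weakenNʳ = Related-map wkNF (unswapʳ-sub wkN-typed)

  unswaps-perm : (p : Γ'' ↭ Γ') (q : Δ'' ↭ Δ') → ∀ {d : Der C Γ'' Δ''} →
    Unswaps a b d → Unswaps a b (perm p q d)
  unswaps-perm p q ih rl rr = ih (Related-↭ p rl) (Related-↭ q rr)

  unswaps-hyp : C ⊢ a ∶ nam ν → C ⊢ b ∶ nam ν → (at : Atomic x) →
    Unswaps a b (hyp {C = C} {Γ = Γ'} {Δ = Δ'} at)
  unswaps-hyp ta tb at rl rr with uncons-atoms (at ∷ []) rl | Related-uncons rr
  ... | _ , _ , pΓ | uncons same _ pΔ = perm (↭-sym pΓ) (↭-sym pΔ) (hyp at) , refl
  ... | _ , _ , pΓ | uncons (swapped atom w _) _ pΔ =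
    let (d , lh-d) = swapped-atom⇒atom ta tb w in perm (↭-sym pΓ) (↭-sym pΔ) d , lh-d

  unswaps-⊤R : Unswaps a b (⊤R {C = C} {Γ = Γ'} {Δ = Δ'})
  unswaps-⊤R rl rr with Related-uncons rr
  ... | uncons same _ pΔ          = perm ↭-refl (↭-sym pΔ) ⊤R , refl
  ... | uncons (swapped ⊤f _ _) _ pΔ = perm ↭-refl (↭-sym pΔ) ⊤R , refl

  unswaps-⊥L : Unswaps a b (⊥L {C = C} {Γ = Γ'} {Δ = Δ'})
  unswaps-⊥L rl rr with Related-uncons rl
  ... | uncons same _ pΓ          = perm (↭-sym pΓ) ↭-refl ⊥L , refl
  ... | uncons (swapped ⊥f _ _) _ pΓ = perm (↭-sym pΓ) ↭-refl ⊥L , refl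

  unswaps-∧L : C ⊢ a ∶ nam ν → C ⊢ b ∶ nam ν → ∀ {d : Der C (φ ∷ ψ ∷ Γ') Δ'} →
    Unswaps a b d → Unswaps a b (∧L d)
  unswaps-∧L ta tb ih rl rr with Related-uncons rl
  ... | uncons same rl' pΓ =
    let (d , e) = ih (same ∷ᴿ same ∷ᴿ rl') rr
    in perm (↭-sym pΓ) ↭-refl (∧L d) , cong suc e
  ... | uncons (swapped (_ ∧f _) (and w₁ w₂) _) rl' pΓ =
    let (_ , r₂ , replace₂) = introˡ ta tb w₂ refl rl'
        (_ , r₁ , replace₁) = introˡ ta tb w₁ refl r₂
        (d , e)   = ih r₁ rr
        (d₁ , e₁) = replace₁ [] d
        (d₂ , e₂) = replace₂ (_ ∷ []) d₁
    in perm (↭-sym pΓ) ↭-refl (∧L d₂) , cong suc (trans e₂ (trans e₁ e))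

  unswaps-∧R : ∀ {d₁ : Der C Γ' (φ ∷ Δ')} {d₂ : Der C Γ' (ψ ∷ Δ')} →
    Unswaps a b d₁ → Unswaps a b d₂ → Unswaps a b (∧R d₁ d₂)
  unswaps-∧R ih₁ ih₂ rl rr with Related-uncons rr
  ... | uncons same rr' pΔ =
    let (d₁ , e₁) = ih₁ rl (same ∷ᴿ rr')
        (d₂ , e₂) = ih₂ rl (same ∷ᴿ rr')
    in perm ↭-refl (↭-sym pΔ) (∧R d₁ d₂) , cong suc (cong₂ _⊔_ e₁ e₂)
  ... | uncons (swapped (_ ∧f _) (and w₁ w₂) _) rr' pΔ =
    let (d₁ , e₁) = ih₁ rl (unswapʳ-swapF w₁ ∷ᴿ rr')
        (d₂ , e₂) = ih₂ rl (unswapʳ-swapF w₂ ∷ᴿ rr')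
    in perm ↭-refl (↭-sym pΔ) (∧R d₁ d₂) , cong suc (cong₂ _⊔_ e₁ e₂)

  unswaps-∨L : C ⊢ a ∶ nam ν → C ⊢ b ∶ nam ν →
    ∀ {d₁ : Der C (φ ∷ Γ') Δ'} {d₂ : Der C (ψ ∷ Γ') Δ'} →
    Unswaps a b d₁ → Unswaps a b d₂ → Unswaps a b (∨L d₁ d₂)
  unswaps-∨L ta tb ih₁ ih₂ rl rr with Related-uncons rl
  ... | uncons same rl' pΓ =
    let (d₁ , e₁) = ih₁ (same ∷ᴿ rl') rr
        (d₂ , e₂) = ih₂ (same ∷ᴿ rl') rr
    in perm (↭-sym pΓ) ↭-refl (∨L d₁ d₂) , cong suc (cong₂ _⊔_ e₁ e₂)
  ... | uncons (swapped (_ ∨f _) (or w₁ w₂) _) rl' pΓ =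
    let (_ , r₁ , replace₁) = introˡ ta tb w₁ refl rl'
        (_ , r₂ , replace₂) = introˡ ta tb w₂ refl rl'
        (d₁ , e₁)   = ih₁ r₁ rr
        (d₂ , e₂)   = ih₂ r₂ rr
        (d₁' , e₁') = replace₁ [] d₁
        (d₂' , e₂') = replace₂ [] d₂
    in perm (↭-sym pΓ) ↭-refl (∨L d₁' d₂')
       , cong suc (cong₂ _⊔_ (trans e₁' e₁) (trans e₂' e₂))

  unswaps-∨R : ∀ {d : Der C Γ' (φ ∷ ψ ∷ Δ')} → Unswaps a b d → Unswaps a b (∨R d)
  unswaps-∨R ih rl rr with Related-uncons rr
  ... | uncons same rr' pΔ =
    let (d , e) = ih rl (same ∷ᴿ same ∷ᴿ rr')
    in perm ↭-refl (↭-sym pΔ) (∨R d) , cong suc e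
  ... | uncons (swapped (_ ∨f _) (or w₁ w₂) _) rr' pΔ =
    let (d , e) = ih rl (unswapʳ-swapF w₁ ∷ᴿ unswapʳ-swapF w₂ ∷ᴿ rr')
    in perm ↭-refl (↭-sym pΔ) (∨R d) , cong suc e

  unswaps-⊃L : C ⊢ a ∶ nam ν → C ⊢ b ∶ nam ν →
    ∀ {d₁ : Der C Γ' (φ ∷ Δ')} {d₂ : Der C (ψ ∷ Γ') Δ'} →
    Unswaps a b d₁ → Unswaps a b d₂ → Unswaps a b (⊃L d₁ d₂)
  unswaps-⊃L ta tb ih₁ ih₂ rl rr with Related-uncons rl
  ... | uncons same rl' pΓ =
    let (d₁ , e₁) = ih₁ rl' (same ∷ᴿ rr)
        (d₂ , e₂) = ih₂ (same ∷ᴿ rl') rr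
    in perm (↭-sym pΓ) ↭-refl (⊃L d₁ d₂) , cong suc (cong₂ _⊔_ e₁ e₂)
  ... | uncons (swapped (_ ⊃f _) (imp w₁ w₂) _) rl' pΓ =
    let (_ , r₂ , replace₂) = introˡ ta tb w₂ refl rl'
        (d₁ , e₁)   = ih₁ rl' (unswapʳ-swapF w₁ ∷ᴿ rr)
        (d₂ , e₂)   = ih₂ r₂ rr
        (d₂' , e₂') = replace₂ [] d₂
    in perm (↭-sym pΓ) ↭-refl (⊃L d₁ d₂') , cong suc (cong₂ _⊔_ e₁ (trans e₂' e₂))

  unswaps-⊃R : C ⊢ a ∶ nam ν → C ⊢ b ∶ nam ν → ∀ {d : Der C (φ ∷ Γ') (ψ ∷ Δ')} →
    Unswaps a b d → Unswaps a b (⊃R d)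
  unswaps-⊃R ta tb ih rl rr with Related-uncons rr
  ... | uncons same rr' pΔ =
    let (d , e) = ih (same ∷ᴿ rl) (same ∷ᴿ rr')
    in perm ↭-refl (↭-sym pΔ) (⊃R d) , cong suc e
  ... | uncons (swapped (_ ⊃f _) (imp w₁ w₂) _) rr' pΔ =
    let (_ , r₁ , replace₁) = introˡ ta tb w₁ refl rl
        (d , e)   = ih r₁ (unswapʳ-swapF w₂ ∷ᴿ rr')
        (d' , e') = replace₁ [] d
    in perm ↭-refl (↭-sym pΔ) (⊃R d') , cong suc (trans e' e)

  unswaps-∀L : C ⊢ a ∶ nam ν → C ⊢ b ∶ nam ν → (⊢t : C ⊢ t ∶ τ) →
    ∀ {d : Der C (inst φ t ∷ ∀f τ φ ∷ Γ') Δ'} → Unswaps a b d → Unswaps a b (∀L ⊢t d)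
  unswaps-∀L ta tb ⊢t ih rl rr with Related-uncons rl
  ... | uncons same rl' pΓ =
    let (d , e) = ih (same ∷ᴿ same ∷ᴿ rl') rr
    in perm (↭-sym pΓ) ↭-refl (∀L ⊢t d) , cong suc e
  unswaps-∀L {a = a} {b = b} {t = t} ta tb ⊢t ih rl rr
    | uncons (swapped (∀f τ χ) (all w) c) rl' pΓ =
    let (_ , r , replace) = introˡ ta tb (subF-wf (single-typed ⊢t) w) (inst-swapF a b χ t)
                                   (swapped (∀f τ χ) (all w) c ∷ᴿ rl')
        (d , e)   = ih r rr
        (d' , e') = replace [] d
    in perm (↭-sym pΓ) ↭-refl (∀L ⊢t d') , cong suc (trans e' e)

  unswaps-∀R : ∀ {d : Der (C ,v τ) (map wkVF Γ') (φ ∷ map wkVF Δ')} →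
    Unswaps (wkV a) (wkV b) d → Unswaps a b (∀R d)
  unswaps-∀R ih rl rr with Related-uncons rr
  ... | uncons same rr' pΔ =
    let (d , e) = ih (weakenVˡ rl) (same ∷ᴿ weakenVʳ rr')
    in perm ↭-refl (↭-sym pΔ) (∀R d) , cong suc e
  ... | uncons (swapped (∀f _ _) (all w) _) rr' pΔ =
    let (d , e) = ih (weakenVˡ rl) (unswapʳ-swapF w ∷ᴿ weakenVʳ rr')
    in perm ↭-refl (↭-sym pΔ) (∀R d) , cong suc e

  unswaps-∃L : C ⊢ a ∶ nam ν → C ⊢ b ∶ nam ν →
    ∀ {d : Der (C ,v τ) (φ ∷ map wkVF Γ') (map wkVF Δ')} →
    Unswaps (wkV a) (wkV b) d → Unswaps a b (∃L d)
  unswaps-∃L ta tb ih rl rr with Related-uncons rl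
  ... | uncons same rl' pΓ =
    let (d , e) = ih (same ∷ᴿ weakenVˡ rl') (weakenVʳ rr)
    in perm (↭-sym pΓ) ↭-refl (∃L d) , cong suc e
  ... | uncons (swapped (∃f _ _) (ex w) _) rl' pΓ =
    let (_ , r , replace) = introˡ (wkV-⊢ ta) (wkV-⊢ tb) w refl
                                   (weakenVˡ rl')
        (d , e)   = ih r (weakenVʳ rr)
        (d' , e') = replace [] d
    in perm (↭-sym pΓ) ↭-refl (∃L d') , cong suc (trans e' e)

  unswaps-∃R : (⊢t : C ⊢ t ∶ τ) → ∀ {d : Der C Γ' (inst φ t ∷ ∃f τ φ ∷ Δ')} →
    Unswaps a b d → Unswaps a b (∃R ⊢t d)
  unswaps-∃R ⊢t ih rl rr with Related-uncons rr
  ... | uncons same rr' pΔ =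
    let (d , e) = ih rl (same ∷ᴿ same ∷ᴿ rr')
    in perm ↭-refl (↭-sym pΔ) (∃R ⊢t d) , cong suc e
  unswaps-∃R {t = t} {a = a} {b = b} ⊢t ih rl rr
    | uncons (swapped (∃f τ χ) (ex w) _) rr' pΔ =
    let inst-swapped = swapped (swapView (inst-swapF a b χ t)) (subF-wf (single-typed ⊢t) w) tt
        (d , e) = ih rl (inst-swapped ∷ᴿ swapped (∃f τ χ) (ex w) tt ∷ᴿ rr')
    in perm ↭-refl (↭-sym pΔ) (∃R ⊢t d) , cong suc e

  unswaps-ИR : ∀ {d : Der (C #n ν) (map wkNF Γ') (φ ∷ map wkNF Δ')} →
    Unswaps (wkN a) (wkN b) d → Unswaps a b (ИR d)
  unswaps-ИR ih rl rr with Related-uncons rr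
  ... | uncons same rr' pΔ =
    let (d , e) = ih (weakenNˡ rl) (same ∷ᴿ weakenNʳ rr')
    in perm ↭-refl (↭-sym pΔ) (ИR d) , cong suc e
  ... | uncons (swapped (Иf _ _) (new w) _) rr' pΔ =
    let (d , e) = ih (weakenNˡ rl) (unswapʳ-swapF w ∷ᴿ weakenNʳ rr')
    in perm ↭-refl (↭-sym pΔ) (ИR d) , cong suc e

  unswaps-ИL : C ⊢ a ∶ nam ν → C ⊢ b ∶ nam ν →
    ∀ {μ} {d : Der (C #n μ) (φ ∷ map wkNF Γ') (map wkNF Δ')} →
    Unswaps (wkN a) (wkN b) d → Unswaps a b (ИL d)
  unswaps-ИL ta tb ih rl rr with Related-uncons rl
  ... | uncons same rl' pΓ =
    let (d , e) = ih (same ∷ᴿ weakenNˡ rl') (weakenNʳ rr)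
    in perm (↭-sym pΓ) ↭-refl (ИL d) , cong suc e
  ... | uncons (swapped (Иf _ _) (new w) _) rl' pΓ =
    let (_ , r , replace) = introˡ (wkN-⊢ ta) (wkN-⊢ tb) w refl
                                   (weakenNˡ rl')
        (d , e)   = ih r (weakenNʳ rr)
        (d' , e') = replace [] d
    in perm (↭-sym pΓ) ↭-refl (ИL d') , cong suc (trans e' e)

  unswaps-≈R : (⊢t : C ⊢ t ∶ τ) → ∀ {d : Der C (t ≈ t ∷ Γ') Δ'} →
    Unswaps a b d → Unswaps a b (≈R ⊢t d)
  unswaps-≈R ⊢t ih rl rr = let (d , e) = ih (same ∷ᴿ rl) rr in ≈R ⊢t d , e

  unswaps-≈S : (at : Atomic x) → ∀ {d : Der C (t ≈ u ∷ inst x t ∷ inst x u ∷ Γ') Δ'} →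
    Unswaps a b d → Unswaps a b (≈S at d)
  unswaps-≈S at ih rl rr =
    let (_ , r , p) = uncons-atoms (atom _ _ ∷ subF-atomic at ∷ []) rl
        (d , e)     = ih (same ∷ᴿ same ∷ᴿ same ∷ᴿ r) rr
    in perm (↭-sym p) ↭-refl (≈S at d) , e

  unswaps-ax : (ax' : Ax C Ps Qs) → ∀ {ds : All (λ Q → Der C (Q ∷ Ps ++ Γ') Δ') Qs} →
    UnswapsAll a b ds → Unswaps a b (ax ax' ds)
  unswaps-ax {Ps = Ps} ax' ih rl rr =
    let (_ , r , p) = uncons-atoms (ax-premises-atomic ax') rl
        (ds , e)    = ih (Related-++ Ps r) rr
    in perm (↭-sym p) ↭-refl (ax ax' ds) , e

  unswaps-A2 : ∀ {c c'} {d₁ : Der C (abst c t ≈ abst c' u ∷ c ≈ c' ∷ t ≈ u ∷ Γ') Δ'}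
    {d₂ : Der C (abst c t ≈ abst c' u ∷ c # u ∷ t ≈ sw c c' u ∷ Γ') Δ'} →
    Unswaps a b d₁ → Unswaps a b d₂ → Unswaps a b (A2 d₁ d₂)
  unswaps-A2 ih₁ ih₂ rl rr =
    let (_ , r , p) = uncons-atoms (atom _ _ ∷ []) rl
        (d₁ , e₁)   = ih₁ (same ∷ᴿ same ∷ᴿ same ∷ᴿ r) rr
        (d₂ , e₂)   = ih₂ (same ∷ᴿ same ∷ᴿ same ∷ᴿ r) rr
    in perm (↭-sym p) ↭-refl (A2 d₁ d₂) , cong₂ _⊔_ e₁ e₂

  unswaps-A3 : (⊢t : C ⊢ t ∶ abs ν τ) → ∀ {d} →
    Unswaps (wkV (wkV a)) (wkV (wkV b)) d → Unswaps a b (A3 {Γ = Γ'} {Δ = Δ'} ⊢t d)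
  unswaps-A3 ⊢t ih rl rr =
    let (d , e) = ih (same ∷ᴿ Related-map wkVF² (λ r → unswapˡ-sub wkV-typed
                                                         (unswapˡ-sub wkV-typed r)) rl)
                     (Related-map wkVF² (λ r → unswapʳ-sub wkV-typed (unswapʳ-sub wkV-typed r)) rr)
    in A3 ⊢t d , e
    where
    wkVF² : Fm → Fm
    wkVF² φ = wkVF (wkVF φ)

  unswaps-F : ∀ {d : Der (C #n ν) (map wkNF Γ') (map wkNF Δ')} →
    Unswaps (wkN a) (wkN b) d → Unswaps a b (F d)
  unswaps-F ih rl rr = let (d , e) = ih (weakenNˡ rl) (weakenNʳ rr) in F d , e

  unswaps-Σ# : (m : C ∋# φ) → ∀ {d : Der C (φ ∷ Γ') Δ'} → Unswaps a b d → Unswaps a b (Σ# m d)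
  unswaps-Σ# m ih rl rr = let (d , e) = ih (same ∷ᴿ rl) rr in Σ# m d , e

  -- The premises are named explicitly: Unswaps a b d unfolds to a type in which
  -- d occurs only under lh, so d cannot be inferred from it.
  mutual
    unswap : C ⊢ a ∶ nam ν → C ⊢ b ∶ nam ν → (d : Der C Γ' Δ') → Unswaps a b d
    unswap ta tb (perm p q d) = unswaps-perm p q {d = d} (unswap ta tb d)
    unswap ta tb (hyp at)     = unswaps-hyp ta tb at
    unswap ta tb ⊤R           = unswaps-⊤R
    unswap ta tb ⊥L           = unswaps-⊥L
    unswap ta tb (∧L d)       = unswaps-∧L ta tb {d = d} (unswap ta tb d)
    unswap ta tb (∧R d₁ d₂)   =
      unswaps-∧R {d₁ = d₁} {d₂ = d₂} (unswap ta tb d₁) (unswap ta tb d₂)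
    unswap ta tb (∨L d₁ d₂)   =
      unswaps-∨L ta tb {d₁ = d₁} {d₂ = d₂} (unswap ta tb d₁) (unswap ta tb d₂)
    unswap ta tb (∨R d)       = unswaps-∨R {d = d} (unswap ta tb d)
    unswap ta tb (⊃L d₁ d₂)   =
      unswaps-⊃L ta tb {d₁ = d₁} {d₂ = d₂} (unswap ta tb d₁) (unswap ta tb d₂)
    unswap ta tb (⊃R d)       = unswaps-⊃R ta tb {d = d} (unswap ta tb d)
    unswap ta tb (∀L ⊢t d)    = unswaps-∀L ta tb ⊢t {d = d} (unswap ta tb d)
    unswap ta tb (∀R d)       = unswaps-∀R {d = d} (unswap (wkV-⊢ ta) (wkV-⊢ tb) d)
    unswap ta tb (∃L d)       = unswaps-∃L ta tb {d = d} (unswap (wkV-⊢ ta) (wkV-⊢ tb) d)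
    unswap ta tb (∃R ⊢t d)    = unswaps-∃R ⊢t {d = d} (unswap ta tb d)
    unswap ta tb (ИR d)       = unswaps-ИR {d = d} (unswap (wkN-⊢ ta) (wkN-⊢ tb) d)
    unswap ta tb (ИL d)       = unswaps-ИL ta tb {d = d} (unswap (wkN-⊢ ta) (wkN-⊢ tb) d)
    unswap ta tb (≈R ⊢t d)    = unswaps-≈R ⊢t {d = d} (unswap ta tb d)
    unswap ta tb (≈S at d)    = unswaps-≈S at {d = d} (unswap ta tb d)
    unswap ta tb (ax ax' ds)  = unswaps-ax ax' {ds = ds} (unswapAll ta tb ds)
    unswap ta tb (A2 d₁ d₂)   =
      unswaps-A2 {d₁ = d₁} {d₂ = d₂} (unswap ta tb d₁) (unswap ta tb d₂)
    unswap ta tb (A3 ⊢t d)    =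
      unswaps-A3 ⊢t {d = d} (unswap (wkV-⊢ (wkV-⊢ ta)) (wkV-⊢ (wkV-⊢ tb)) d)
    unswap ta tb (F d)        = unswaps-F {d = d} (unswap (wkN-⊢ ta) (wkN-⊢ tb) d)
    unswap ta tb (Σ# m d)     = unswaps-Σ# m {d = d} (unswap ta tb d)

    unswapAll : C ⊢ a ∶ nam ν → C ⊢ b ∶ nam ν →
      (ds : All (λ Q → Der C (Q ∷ Θ') Δ') Qs) → UnswapsAll a b ds
    unswapAll ta tb []       rl rr = [] , refl
    unswapAll ta tb (d ∷ ds) rl rr =
      let (d' , e)   = unswap ta tb d (same ∷ᴿ rl) rr
          (ds' , es) = unswapAll ta tb ds rl rr
      in d' ∷ ds' , cong₂ _⊔_ e es

  swap-admissibleˡ : C ⊢ a ∶ nam ν → C ⊢ b ∶ nam ν → C ⊢ φ wf →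
    (d : Der C (swapF a b φ ∷ Γ) Δ) → Σ[ d' ∈ Der C (φ ∷ Γ) Δ ] lh d' ≡ lh d
  swap-admissibleˡ ta tb w d =
    let (_ , r , replace) = introˡ ta tb w refl (Related-refl _)
        (d₁ , e₁) = unswap ta tb d r (Related-refl _)
        (d₂ , e₂) = replace [] d₁
    in d₂ , trans e₂ e₁

  swap-admissibleʳ : C ⊢ a ∶ nam ν → C ⊢ b ∶ nam ν → C ⊢ φ wf →
    (d : Der C Γ (swapF a b φ ∷ Δ)) → Σ[ d' ∈ Der C Γ (φ ∷ Δ) ] lh d' ≡ lh d
  swap-admissibleʳ ta tb w d =
    unswap ta tb d (Related-refl _) (unswapʳ-swapF w ∷ᴿ Related-refl _)

mainTheorem16 : (𝕊 : Sig) → let open Sig 𝕊 in let open NL 𝕊 in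
    (C : Ctx) (a b : Tm) (ν : NTy) (φ : Fm) (Γ Δ : List Fm) →
    C ⊢ a ∶ nam ν → C ⊢ b ∶ nam ν → C ⊢ φ wf →
    ((d : Der C (swapF a b φ ∷ Γ) Δ) →
    Σ[ d' ∈ Der C (φ ∷ Γ) Δ ] lh d' ≡ lh d)
    × ((d : Der C Γ (swapF a b φ ∷ Δ)) →
    Σ[ d' ∈ Der C Γ (φ ∷ Δ) ] lh d' ≡ lh d)
mainTheorem16 𝕊 C a b ν φ Γ Δ ta tb w = swap-admissibleˡ ta tb w , swap-admissibleʳ ta tb w
  where open SwapAdmissibility 𝕊
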